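{- Let $G=(V,E)$ be a finite oriented graph. Then $\mathcal{B}_G$ is in bijection with the set $\{I_{{}_\sigma G}: \sigma\subseteq E \text{ a totally cyclic reorientation of } G\}$.
   Context: Oriented graphs may have loops and multiple edges. The incidence matrix $A\in\{0,\pm1\}^{V\times E}$ has $A_{v,e}=1$ if the non-loop edge $e$ enters $v$, $-1$ if it leaves $v$, $0$ otherwise. $\mathcal{B}_G=\{b\in\mathbb{Z}^V: \exists p\in\mathbb{R}^E \text{ with } Ap=b,\ 0<p_e<1\ \forall e\}$. For an oriented graph $H$ on vertex set $V$, the in-degree sequence $I_H\in\mathbb{Z}^V$ records for each vertex $v$ the number of edges of $H$ entering $v$. For $\sigma\subseteq E$, ${}_\sigma G$ is $G$ with the edges of $\sigma$ reversed; $\sigma$ is a totally cyclic reorientation if every edge of ${}_\sigma G$ lies on a directed cycle.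
   Formalization: The vectors p in the definition of $\mathcal{B}_G$ have rational entries rather than real ones. -}

module Defs where

open import Data.Nat using (ℕ; zero; suc)
open import Data.Fin using (Fin; zero; suc; inject₁; fromℕ; _≟_)
open import Data.Bool using (Bool; true; false; if_then_else_)
open import Data.Integer using (ℤ)
open import Data.Rational using (ℚ; 0ℚ; 1ℚ; _+_; _*_; -_; _<_)
import Data.Rational as ℚ
open import Data.Vec using (Vec; tabulate; lookup)
open import Data.Product using (Σ; _×_; proj₁)
open import Data.Fin.Subset using (Subset; _∈_)
open import Relation.Nullary using (yes; no; does)
open import Relation.Binary.PropositionalEquality using (_≡_)
import Relation.Binary.PropositionalEquality as ≡
open import Relation.Binary.Bundles using (Setoid)
import Relation.Binary.Construct.On as On
open import Function.Bundles using (Bijection)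
open import Level using (0ℓ)

-- A finite oriented graph: vertices Fin n, edges Fin m; edge e goes from
-- tail e to head e.  Loops (tail e ≡ head e) and multiple edges are allowed.
record Graph (n m : ℕ) : Set where
  field
    tail : Fin m → Fin n
    head : Fin m → Fin n
open Graph public

∑ : ∀ {m} → (Fin m → ℚ) → ℚ
∑ {zero}  f = 0ℚ
∑ {suc m} f = f zero + ∑ (λ i → f (suc i))

incidence : ∀ {n m} → Graph n m → Fin n → Fin m → ℚ
incidence G v e with tail G e ≟ head G e
... | yes _ = 0ℚ
... | no _ with head G e ≟ v
...   | yes _ = 1ℚ
...   | no _ with tail G e ≟ v
...     | yes _ = - 1ℚ
...     | no _ = 0ℚ

InB : ∀ {n m} → Graph n m → Vec ℤ n → Set
InB {n} {m} G b =
  Σ (Fin m → ℚ) λ p →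
    (∀ e → (0ℚ < p e) × (p e < 1ℚ)) ×
    (∀ v → ∑ (λ e → incidence G v e * p e) ≡ (lookup b v ℚ./ 1))

reorient : ∀ {n m} → Subset m → Graph n m → Graph n m
reorient σ G = record
  { tail = λ e → if lookup σ e then head G e else tail G e
  ; head = λ e → if lookup σ e then tail G e else head G e }

count : ∀ {m} → (Fin m → Bool) → ℕ
count {zero}  f = 0
count {suc m} f = (if f zero then 1 else 0) Data.Nat.+ count (λ i → f (suc i))

inDeg : ∀ {n m} → Graph n m → Vec ℤ n
inDeg G = tabulate λ v → ℤ.+ count (λ e → does (head G e ≟ v))
  where import Data.Integer as ℤ

record DirCycleThrough {n m} (H : Graph n m) (e : Fin m) : Set where
  field
    len      : ℕ
    es       : Fin (suc len) → Fin m
    starts   : es zero ≡ e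
    consec   : ∀ (i : Fin len) → head H (es (inject₁ i)) ≡ tail H (es (suc i))
    closes   : head H (es (fromℕ len)) ≡ tail H (es zero)
    distinct : ∀ i j → tail H (es i) ≡ tail H (es j) → i ≡ j

TotallyCyclic : ∀ {n m} → Graph n m → Set
TotallyCyclic {m = m} H = ∀ (e : Fin m) → DirCycleThrough H e

TotallyCyclicReorientation : ∀ {n m} → Graph n m → Subset m → Set
TotallyCyclicReorientation G σ = TotallyCyclic (reorient σ G)

-- the sets, as setoids whose equality is equality of the integer vectors
BSetoid : ∀ {n m} → Graph n m → Setoid 0ℓ 0ℓ
BSetoid {n} G = On.setoid (≡.setoid (Vec ℤ n)) (proj₁ {B = InB G})

InDegSeqOfTCR : ∀ {n m} → Graph n m → Vec ℤ n → Set
InDegSeqOfTCR {n} {m} G b =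
  Σ (Subset m) λ σ → TotallyCyclicReorientation G σ × (inDeg (reorient σ G) ≡ b)

TCRInDegSetoid : ∀ {n m} → Graph n m → Setoid 0ℓ 0ℓ
TCRInDegSetoid {n} G = On.setoid (≡.setoid (Vec ℤ n)) (proj₁ {B = InDegSeqOfTCR G})

-- The bijection is b ↦ b + outdeg(G). For σ ⊆ E and a flow y on G let y^σ be the
-- flow on σG equal to y on the reversed edges and to 1 − y on the others; edge by
-- edge, A_{σG} y^σ = indeg(σG) − outdeg(G) − A_G y, and y^σ ∈ (0,1)^E iff y ∈ (0,1)^E.
--
-- If σG is totally cyclic, the sum over all edges of the occurrence vector of a
-- directed cycle through that edge, suitably scaled, is a circulation on σG with
-- values in (0,1); pulling it back gives y with A_G y = indeg(σG) − outdeg(G).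
--
-- Conversely let A_G y = b with y ∈ (0,1)^E. The defect indeg(σG) − outdeg(G) − b
-- is the excess of the strictly positive flow y^σ on σG. Summing the excess over a
-- vertex set R gives the net flow into R, which is ≤ 0 when R is closed under
-- predecessors, and < 0 when moreover some edge leaves R. Since the defects sum to
-- zero, a non-zero defect yields a vertex t of positive defect and then, among the
-- ancestors of t, a vertex v of negative defect; reversing a simple walk from v to t
-- lowers the sum of the absolute defects. Once the defect vanishes, y^σ is a strictly
-- positive circulation on σG, so no edge can leave the ancestor set of its own tail:
-- every edge lies on a directed cycle.

module Submission where

open import Defs
open import Algebra.Bundles using (CommutativeRing)
import Algebra.Properties.Monoid.Sum as MonoidSum
open import Data.Bool using (Bool; true; false; if_then_else_; _∨_; not)
import Data.Bool as Bool
open import Data.Bool.Properties using (∨-zeroʳ; ∨-identityʳ)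
open import Data.Empty using (⊥-elim)
open import Data.Fin using (Fin; zero; suc; inject₁; fromℕ; _≟_)
import Data.Fin.Properties as Fin
open import Data.Fin.Properties using (any?; all?; ¬∀⟶∃¬)
open import Data.Fin.Subset using (Subset)
open import Data.Integer as ℤ using (ℤ; +_)
import Data.Integer.Properties as ℤ
import Data.Integer.Tactic.RingSolver as ℤ-Ring
open import Data.List using (List; []; _∷_)
import Data.List as List
open import Data.List.Membership.Propositional using (_∈_)
open import Data.List.Relation.Unary.All using (All; []; _∷_)
import Data.List.Relation.Unary.All as All
open import Data.List.Relation.Unary.AllPairs using ([]; _∷_)
open import Data.List.Relation.Unary.Any using (here; there)
open import Data.List.Relation.Unary.Unique.Propositional using (Unique)
open import Data.Nat as ℕ using (ℕ; zero; suc)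
import Data.Nat.Induction as ℕ
import Data.Nat.Properties as ℕ
import Data.Nat.Tactic.RingSolver as ℕ-Ring
open import Data.Product using (Σ; ∃; _×_; _,_; proj₁; proj₂)
open import Data.Rational as ℚ
  using (ℚ; 0ℚ; 1ℚ; _+_; _*_; -_; _-_; _<_; _≤_; 1/_; toℚᵘ; Positive; NonZero; positive)
open import Data.Rational.Properties
  using ( +-*-commutativeRing; +-identityˡ; +-identityʳ; +-comm; +-inverseʳ; neg-distrib-+
        ; *-identityˡ; *-zeroˡ; *-zeroʳ; *-comm; *-monoˡ-≤-nonNeg; *-monoʳ-<-pos; *-inverseˡ
        ; positive⁻¹; pos⇒nonNeg; pos⇒nonZero; 1/pos⇒pos
        ; ≤-refl; ≤-trans; ≤-reflexive; <-irrefl; <⇒≤; <-≤-trans; ≤-<-trans; module ≤-Reasoning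
        ; +-mono-≤; +-monoˡ-≤; +-monoʳ-≤; +-monoˡ-<; +-monoʳ-<; neg-antimono-<
        ; toℚᵘ-injective; toℚᵘ-fromℚᵘ; toℚᵘ-homo-+; toℚᵘ-homo‿-; toℚᵘ-cancel-≤; toℚᵘ-cancel-<)
open import Data.Rational.Solver using (module +-*-Solver)
import Data.Rational.Unnormalised as ℚᵘ
import Data.Rational.Unnormalised.Properties as ℚᵘ
open import Data.Vec using (Vec; lookup; tabulate; updateAt)
open import Data.Vec.Properties
  using (lookup∘tabulate; tabulate∘lookup; tabulate-cong; lookup∘updateAt; lookup∘updateAt′)
open import Function using (_∘_)
open import Function.Bundles using (Bijection)
open import Function.Properties.Inverse using (Inverse⇒Bijection)
open import Induction.WellFounded using (Acc; acc)
open import Relation.Binary.PropositionalEquality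
open import Relation.Nullary using (Dec; yes; no; does)
open import Relation.Nullary.Decidable using (dec-true; dec-false; _×-dec_)

open import Algebra.Properties.AbelianGroup (CommutativeRing.+-abelianGroup +-*-commutativeRing)
  using (x∙y⁻¹≈ε⇒x≈y)
open import Algebra.Properties.CommutativeSemigroup (CommutativeRing.*-commutativeSemigroup +-*-commutativeRing)
  using (x∙yz≈y∙xz; x∙yz≈z∙xy)
open import Algebra.Properties.Ring (CommutativeRing.ring +-*-commutativeRing)
  using (x[y-z]≈xy-xz)
open import Algebra.Properties.Semiring.Sum (CommutativeRing.semiring +-*-commutativeRing)
  using (sum; sum-cong-≗; sum-replicate-zero; ∑-distrib-+; ∑-comm; *-distribˡ-sum; sum-init-last)

∑≡sum : ∀ {m} (f : Fin m → ℚ) → ∑ f ≡ sum f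
∑≡sum {zero}  f = refl
∑≡sum {suc m} f = cong (λ s → f zero + s) (∑≡sum (λ i → f (suc i)))

sum-neg : ∀ {k} (f : Fin k → ℚ) → sum (λ i → - f i) ≡ - sum f
sum-neg {zero}  f = refl
sum-neg {suc k} f =
  trans (cong (λ s → - f zero + s) (sum-neg (λ i → f (suc i)))) (sym (neg-distrib-+ (f zero) _))

∑-distrib-- : ∀ {k} (f g : Fin k → ℚ) → sum (λ i → f i - g i) ≡ sum f - sum g
∑-distrib-- f g = trans (∑-distrib-+ f (λ i → - g i)) (cong (λ s → sum f + s) (sum-neg g))

sum-rotate : ∀ {k} (g h : Fin (suc k) → ℚ) →
             (∀ i → g (inject₁ i) ≡ h (suc i)) → g (fromℕ k) ≡ h zero → sum g ≡ sum h
sum-rotate g h g≡h∘suc g-last≡h₀ = begin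
  sum g                                   ≡⟨ sum-init-last g ⟩
  sum (λ i → g (inject₁ i)) + g (fromℕ _) ≡⟨ cong₂ _+_ (sum-cong-≗ g≡h∘suc) g-last≡h₀ ⟩
  sum (λ i → h (suc i)) + h zero          ≡⟨ +-comm _ (h zero) ⟩
  sum h                                   ∎
  where open ≡-Reasoning

𝟙 : Bool → ℚ
𝟙 true  = 1ℚ
𝟙 false = 0ℚ

𝟙-nonNeg : ∀ b → 0ℚ ≤ 𝟙 b
𝟙-nonNeg true  = <⇒≤ (positive⁻¹ 1ℚ)
𝟙-nonNeg false = ≤-refl

δ : ∀ {k} → Fin k → Fin k → ℚ
δ a b = 𝟙 (does (a ≟ b))

δ-refl : ∀ {k} (a : Fin k) → δ a a ≡ 1ℚ
δ-refl a with a ≟ a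
... | yes _ = refl
... | no a≢a = ⊥-elim (a≢a refl)

∑-δ : ∀ {k} (a : Fin k) (g : Fin k → ℚ) → sum (λ i → δ a i * g i) ≡ g a
∑-δ {suc k} zero g = begin
  1ℚ * g zero + sum (λ i → 0ℚ * g (suc i))
    ≡⟨ cong (λ s → 1ℚ * g zero + s) (trans (sum-cong-≗ (λ i → *-zeroˡ (g (suc i)))) (sum-replicate-zero k)) ⟩
  1ℚ * g zero + 0ℚ                          ≡⟨ trans (+-identityʳ _) (*-identityˡ _) ⟩
  g zero                                    ∎
  where open ≡-Reasoning
∑-δ {suc k} (suc a) g = begin
  0ℚ * g zero + sum (λ i → δ a i * g (suc i)) ≡⟨ cong₂ _+_ (*-zeroˡ (g zero)) (∑-δ a (λ i → g (suc i))) ⟩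
  0ℚ + g (suc a)                              ≡⟨ +-identityˡ _ ⟩
  g (suc a)                                   ∎
  where open ≡-Reasoning

sum-mono-≤ : ∀ {k} {f g : Fin k → ℚ} → (∀ i → f i ≤ g i) → sum f ≤ sum g
sum-mono-≤ {zero}  f≤g = ≤-refl
sum-mono-≤ {suc k} f≤g = +-mono-≤ (f≤g zero) (sum-mono-≤ (λ i → f≤g (suc i)))

sum-nonNeg : ∀ {k} {f : Fin k → ℚ} → (∀ i → 0ℚ ≤ f i) → 0ℚ ≤ sum f
sum-nonNeg {k} {f} f≥0 = subst (_≤ sum f) (sum-replicate-zero k) (sum-mono-≤ f≥0)

sum-nonPos : ∀ {k} {f : Fin k → ℚ} → (∀ i → f i ≤ 0ℚ) → sum f ≤ 0ℚ
sum-nonPos {k} {f} f≤0 = subst (sum f ≤_) (sum-replicate-zero k) (sum-mono-≤ f≤0)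

term≤sum : ∀ {k} {f : Fin k → ℚ} → (∀ i → 0ℚ ≤ f i) → ∀ a → f a ≤ sum f
term≤sum {suc k} {f} f≥0 zero =
  subst (_≤ sum f) (+-identityʳ (f zero)) (+-monoʳ-≤ (f zero) (sum-nonNeg (λ i → f≥0 (suc i))))
term≤sum {suc k} {f} f≥0 (suc a) = ≤-trans (term≤sum (λ i → f≥0 (suc i)) a)
  (subst (_≤ sum f) (+-identityˡ _) (+-monoˡ-≤ (sum (λ i → f (suc i))) (f≥0 zero)))

sum≤term : ∀ {k} {f : Fin k → ℚ} → (∀ i → f i ≤ 0ℚ) → ∀ a → sum f ≤ f a
sum≤term {suc k} {f} f≤0 zero =
  subst (sum f ≤_) (+-identityʳ (f zero)) (+-monoʳ-≤ (f zero) (sum-nonPos (λ i → f≤0 (suc i))))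
sum≤term {suc k} {f} f≤0 (suc a) = ≤-trans
  (subst (sum f ≤_) (+-identityˡ _) (+-monoˡ-≤ (sum (λ i → f (suc i))) (f≤0 zero)))
  (sum≤term (λ i → f≤0 (suc i)) a)

InOpenUnit : ℚ → Set
InOpenUnit x = (0ℚ < x) × (x < 1ℚ)

scale-into-openUnit : ∀ N → 0ℚ ≤ N → Σ ℚ λ ε → ∀ x → 0ℚ < x → x ≤ N → InOpenUnit (ε * x)
scale-into-openUnit N 0≤N = ε , λ x 0<x x≤N →
    subst (_< ε * x) (*-zeroʳ ε) (*-monoʳ-<-pos ε 0<x)
  , (begin-strict
      ε * x          ≤⟨ *-monoˡ-≤-nonNeg ε {{pos⇒nonNeg ε}} x≤N ⟩
      ε * N          <⟨ *-monoʳ-<-pos ε N<N+1 ⟩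
      ε * (N + 1ℚ)   ≡⟨ *-inverseˡ (N + 1ℚ) {{N+1≢0}} ⟩
      1ℚ             ∎)
  where
  open ≤-Reasoning
  0<1 : 0ℚ < 1ℚ
  0<1 = positive⁻¹ 1ℚ
  N<N+1 : N < N + 1ℚ
  N<N+1 = subst (_< N + 1ℚ) (+-identityʳ N) (+-monoʳ-< N 0<1)
  instance
    N+1>0 : Positive (N + 1ℚ)
    N+1>0 = positive (≤-<-trans 0≤N N<N+1)
  N+1≢0 : NonZero (N + 1ℚ)
  N+1≢0 = pos⇒nonZero (N + 1ℚ)
  ε : ℚ
  ε = (1/ (N + 1ℚ)) {{N+1≢0}}
  instance
    ε>0 : Positive ε
    ε>0 = 1/pos⇒pos (N + 1ℚ)

1-openUnit : ∀ {x} → InOpenUnit x → InOpenUnit (1ℚ - x)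
1-openUnit {x} (0<x , x<1) =
    subst (_< 1ℚ - x) (+-inverseʳ x) (+-monoˡ-< (- x) x<1)
  , subst (1ℚ - x <_) (+-identityʳ 1ℚ) (+-monoʳ-< 1ℚ (neg-antimono-< 0<x))

bit : Bool → ℕ
bit b = if b then 1 else 0

count-≤ : ∀ {k} (P : Fin k → Bool) → count P ℕ.≤ k
count-≤ {zero}  P = ℕ.z≤n
count-≤ {suc k} P = ℕ.+-mono-≤ (bit≤1 (P zero)) (count-≤ (λ i → P (suc i)))
  where
  bit≤1 : ∀ b → bit b ℕ.≤ 1
  bit≤1 true  = ℕ.≤-refl
  bit≤1 false = ℕ.z≤n

count-cong : ∀ {k} {P Q : Fin k → Bool} → (∀ i → P i ≡ Q i) → count P ≡ count Q
count-cong {zero}  P≡Q = refl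
count-cong {suc k} P≡Q = cong₂ (λ b c → bit b ℕ.+ c) (P≡Q zero) (count-cong (λ i → P≡Q (suc i)))

count-update : ∀ {k} (P Q : Fin k → Bool) a → (∀ i → i ≢ a → Q i ≡ P i) →
               count Q ℕ.+ bit (P a) ≡ count P ℕ.+ bit (Q a)
count-update {suc k} P Q zero Q≡P
  rewrite count-cong (λ i → Q≡P (suc i) (λ ())) =
  outer-swap (bit (Q zero)) (count (λ i → P (suc i))) (bit (P zero))
  where
  outer-swap : ∀ x c y → (x ℕ.+ c) ℕ.+ y ≡ (y ℕ.+ c) ℕ.+ x
  outer-swap = ℕ-Ring.solve-∀
count-update {suc k} P Q (suc a) Q≡P rewrite Q≡P zero (λ ()) = begin
  (bit (P zero) ℕ.+ count (λ i → Q (suc i))) ℕ.+ bit (P (suc a))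
    ≡⟨ ℕ.+-assoc (bit (P zero)) _ _ ⟩
  bit (P zero) ℕ.+ (count (λ i → Q (suc i)) ℕ.+ bit (P (suc a)))
    ≡⟨ cong (bit (P zero) ℕ.+_) (count-update (λ i → P (suc i)) (λ i → Q (suc i)) a
         (λ i i≢a → Q≡P (suc i) (λ 1+i≡1+a → i≢a (Fin.suc-injective 1+i≡1+a)))) ⟩
  bit (P zero) ℕ.+ (count (λ i → P (suc i)) ℕ.+ bit (Q (suc a)))
    ≡⟨ ℕ.+-assoc (bit (P zero)) _ _ ⟨
  (bit (P zero) ℕ.+ count (λ i → P (suc i))) ℕ.+ bit (Q (suc a)) ∎
  where open ≡-Reasoning

insert : ∀ {k} → (Fin k → Bool) → Fin k → Fin k → Bool
insert P a x = P x ∨ does (x ≟ a)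

insert-⊇ : ∀ {k} (P : Fin k → Bool) a {x} → P x ≡ true → insert P a x ≡ true
insert-⊇ P a Px rewrite Px = refl

insert-new : ∀ {k} (P : Fin k → Bool) a → insert P a a ≡ true
insert-new P a rewrite dec-true (a ≟ a) refl = ∨-zeroʳ (P a)

insert-other : ∀ {k} (P : Fin k → Bool) a i → i ≢ a → insert P a i ≡ P i
insert-other P a i i≢a rewrite dec-false (i ≟ a) i≢a = ∨-identityʳ (P i)

count-insert : ∀ {k} (P : Fin k → Bool) a → P a ≡ false → count (insert P a) ≡ suc (count P)
count-insert P a Pa≡false = begin
  count (insert P a)                      ≡⟨ ℕ.+-identityʳ _ ⟨
  count (insert P a) ℕ.+ bit false        ≡⟨ cong (λ b → count (insert P a) ℕ.+ bit b) Pa≡false ⟨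
  count (insert P a) ℕ.+ bit (P a)        ≡⟨ count-update P (insert P a) a (insert-other P a) ⟩
  count P ℕ.+ bit (insert P a a)          ≡⟨ cong (λ b → count P ℕ.+ bit b) (insert-new P a) ⟩
  count P ℕ.+ 1                           ≡⟨ ℕ.+-comm (count P) 1 ⟩
  suc (count P)                           ∎
  where open ≡-Reasoning

count<size : ∀ {k} (P : Fin k → Bool) a → P a ≡ false → count P ℕ.< k
count<size P a Pa≡false = subst (ℕ._≤ _) (count-insert P a Pa≡false) (count-≤ (insert P a))

ι : ℤ → ℚ
ι a = a ℚ./ 1

private
  toℚᵘ-ι : ∀ a → toℚᵘ (ι a) ℚᵘ.≃ ℚᵘ.mkℚᵘ a 0
  toℚᵘ-ι a = toℚᵘ-fromℚᵘ (ℚᵘ.mkℚᵘ a 0)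

ι-homo-+ : ∀ a b → ι (a ℤ.+ b) ≡ ι a + ι b
ι-homo-+ a b = toℚᵘ-injective (begin
  toℚᵘ (ι (a ℤ.+ b))            ≈⟨ toℚᵘ-ι (a ℤ.+ b) ⟩
  ℚᵘ.mkℚᵘ (a ℤ.+ b) 0           ≈⟨ ℚᵘ.*≡* (unit-denominators a b) ⟩
  ℚᵘ.mkℚᵘ a 0 ℚᵘ.+ ℚᵘ.mkℚᵘ b 0  ≈⟨ ℚᵘ.+-cong (toℚᵘ-ι a) (toℚᵘ-ι b) ⟨
  toℚᵘ (ι a) ℚᵘ.+ toℚᵘ (ι b)    ≈⟨ toℚᵘ-homo-+ (ι a) (ι b) ⟨
  toℚᵘ (ι a + ι b)              ∎)
  where
  open import Relation.Binary.Reasoning.Setoid ℚᵘ.≃-setoid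
  unit-denominators : ∀ a b → (a ℤ.+ b) ℤ.* + 1 ≡ (a ℤ.* + 1 ℤ.+ b ℤ.* + 1) ℤ.* + 1
  unit-denominators = ℤ-Ring.solve-∀

ι-homo-‿- : ∀ a → ι (ℤ.- a) ≡ - ι a
ι-homo-‿- a = toℚᵘ-injective (ℚᵘ.≃-trans (toℚᵘ-ι (ℤ.- a))
  (ℚᵘ.≃-sym (ℚᵘ.≃-trans (toℚᵘ-homo‿- (ι a)) (ℚᵘ.-‿cong (toℚᵘ-ι a)))))

ι-homo-- : ∀ a b → ι (a ℤ.- b) ≡ ι a - ι b
ι-homo-- a b = trans (ι-homo-+ a (ℤ.- b)) (cong (λ s → ι a + s) (ι-homo-‿- b))

ι-mono-≤ : ∀ {a b} → a ℤ.≤ b → ι a ≤ ι b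
ι-mono-≤ {a} {b} a≤b = toℚᵘ-cancel-≤
  (ℚᵘ.≤-respˡ-≃ (ℚᵘ.≃-sym (toℚᵘ-ι a)) (ℚᵘ.≤-respʳ-≃ (ℚᵘ.≃-sym (toℚᵘ-ι b))
    (ℚᵘ.*≤* (subst₂ ℤ._≤_ (sym (ℤ.*-identityʳ a)) (sym (ℤ.*-identityʳ b)) a≤b))))

ι-mono-< : ∀ {a b} → a ℤ.< b → ι a < ι b
ι-mono-< {a} {b} a<b = toℚᵘ-cancel-<
  (ℚᵘ.<-respˡ-≃ (ℚᵘ.≃-sym (toℚᵘ-ι a)) (ℚᵘ.<-respʳ-≃ (ℚᵘ.≃-sym (toℚᵘ-ι b))
    (ℚᵘ.*<* (subst₂ ℤ._<_ (sym (ℤ.*-identityʳ a)) (sym (ℤ.*-identityʳ b)) a<b))))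

sum-𝟙≡count : ∀ {k} (P : Fin k → Bool) → sum (λ i → 𝟙 (P i)) ≡ ι (+ count P)
sum-𝟙≡count {zero}  P = refl
sum-𝟙≡count {suc k} P = trans (cong₂ _+_ (𝟙≡ι (P zero)) (sum-𝟙≡count (λ i → P (suc i))))
  (sym (ι-homo-+ (+ bit (P zero)) (+ count (λ i → P (suc i)))))
  where
  𝟙≡ι : ∀ b → 𝟙 b ≡ ι (+ bit b)
  𝟙≡ι true  = refl
  𝟙≡ι false = refl

shiftBy : ∀ {n} → (Fin n → ℤ) → Vec ℤ n → Vec ℤ n
shiftBy d b = tabulate (λ v → lookup b v ℤ.+ d v)

shiftBy-cancel : ∀ {n} (d d′ : Fin n → ℤ) → (∀ v → d v ℤ.+ d′ v ≡ + 0) → ∀ b → shiftBy d′ (shiftBy d b) ≡ b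
shiftBy-cancel d d′ d+d′≡0 b = trans (tabulate-cong λ v → begin
  lookup (shiftBy d b) v ℤ.+ d′ v    ≡⟨ cong (ℤ._+ d′ v) (lookup∘tabulate (λ v → lookup b v ℤ.+ d v) v) ⟩
  (lookup b v ℤ.+ d v) ℤ.+ d′ v      ≡⟨ ℤ.+-assoc (lookup b v) (d v) (d′ v) ⟩
  lookup b v ℤ.+ (d v ℤ.+ d′ v)      ≡⟨ cong (λ s → lookup b v ℤ.+ s) (d+d′≡0 v) ⟩
  lookup b v ℤ.+ + 0                 ≡⟨ ℤ.+-identityʳ (lookup b v) ⟩
  lookup b v                         ∎) (tabulate∘lookup b)
  where open ≡-Reasoning

-- Flows and their excess

module _ {m : ℕ} where

  reorientFlow : Subset m → (Fin m → ℚ) → Fin m → ℚ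
  reorientFlow σ y e = if lookup σ e then y e else 1ℚ - y e

  reorientFlow-involutive : ∀ σ y e → reorientFlow σ (reorientFlow σ y) e ≡ y e
  reorientFlow-involutive σ y e with lookup σ e
  ... | true  = refl
  ... | false = solve 1 (λ x → con 1ℚ :- (con 1ℚ :- x) := x) refl (y e)
    where open +-*-Solver

  reorientFlow-openUnit : ∀ σ {y} e → InOpenUnit (y e) → InOpenUnit (reorientFlow σ y e)
  reorientFlow-openUnit σ e y∈ with lookup σ e
  ... | true  = y∈
  ... | false = 1-openUnit y∈

module _ {n m : ℕ} where

  excess : Graph n m → (Fin m → ℚ) → Fin n → ℚ
  excess H p v = sum (λ e → incidence H v e * p e)

  incidence≡δ-δ : ∀ (H : Graph n m) v e → incidence H v e ≡ δ (head H e) v - δ (tail H e) v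
  incidence≡δ-δ H v e with tail H e ≟ head H e
  ... | yes t≡h rewrite t≡h = sym (+-inverseʳ (δ (head H e) v))
  ... | no t≢h with head H e ≟ v
  ...   | yes h≡v with tail H e ≟ v
  ...     | yes t≡v = ⊥-elim (t≢h (trans t≡v (sym h≡v)))
  ...     | no _    = refl
  incidence≡δ-δ H v e | no _ | no _ with tail H e ≟ v
  ...     | yes _ = refl
  ...     | no _  = refl

  ∑-weighted-incidence : ∀ (H : Graph n m) (g : Fin n → ℚ) e →
                         sum (λ v → g v * incidence H v e) ≡ g (head H e) - g (tail H e)
  ∑-weighted-incidence H g e = begin
    sum (λ v → g v * incidence H v e)
      ≡⟨ sum-cong-≗ (λ v → trans (cong (g v *_) (incidence≡δ-δ H v e))
           (trans (x[y-z]≈xy-xz (g v) (δ (head H e) v) (δ (tail H e) v))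
             (cong₂ _-_ (*-comm (g v) (δ (head H e) v)) (*-comm (g v) (δ (tail H e) v))))) ⟩
    sum (λ v → δ (head H e) v * g v - δ (tail H e) v * g v)
      ≡⟨ ∑-distrib-- (λ v → δ (head H e) v * g v) (λ v → δ (tail H e) v * g v) ⟩
    sum (λ v → δ (head H e) v * g v) - sum (λ v → δ (tail H e) v * g v)
      ≡⟨ cong₂ _-_ (∑-δ (head H e) g) (∑-δ (tail H e) g) ⟩
    g (head H e) - g (tail H e) ∎
    where open ≡-Reasoning

  ∑-weighted-excess : ∀ (H : Graph n m) (g : Fin n → ℚ) (p : Fin m → ℚ) →
                      sum (λ v → g v * excess H p v) ≡ sum (λ e → p e * (g (head H e) - g (tail H e)))
  ∑-weighted-excess H g p = begin
    sum (λ v → g v * excess H p v)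
      ≡⟨ sum-cong-≗ (λ v → *-distribˡ-sum (g v) (λ e → incidence H v e * p e)) ⟩
    sum (λ v → sum (λ e → g v * (incidence H v e * p e)))
      ≡⟨ ∑-comm (λ v e → g v * (incidence H v e * p e)) ⟩
    sum (λ e → sum (λ v → g v * (incidence H v e * p e)))
      ≡⟨ sum-cong-≗ (λ e → sum-cong-≗ (λ v → x∙yz≈z∙xy (g v) (incidence H v e) (p e))) ⟩
    sum (λ e → sum (λ v → p e * (g v * incidence H v e)))
      ≡⟨ sum-cong-≗ (λ e → sym (*-distribˡ-sum (p e) (λ v → g v * incidence H v e))) ⟩
    sum (λ e → p e * sum (λ v → g v * incidence H v e))
      ≡⟨ sum-cong-≗ (λ e → cong (p e *_) (∑-weighted-incidence H g e)) ⟩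
    sum (λ e → p e * (g (head H e) - g (tail H e))) ∎
    where open ≡-Reasoning

  sum-excess≡0 : ∀ (H : Graph n m) p → sum (excess H p) ≡ 0ℚ
  sum-excess≡0 H p = begin
    sum (excess H p)               ≡⟨ sum-cong-≗ (λ v → *-identityˡ (excess H p v)) ⟨
    sum (λ v → 1ℚ * excess H p v)  ≡⟨ ∑-weighted-excess H (λ _ → 1ℚ) p ⟩
    sum (λ e → p e * (1ℚ - 1ℚ))    ≡⟨ sum-cong-≗ (λ e → *-zeroʳ (p e)) ⟩
    sum {m} (λ _ → 0ℚ)             ≡⟨ sum-replicate-zero m ⟩
    0ℚ                             ∎
    where open ≡-Reasoning

  excess-δ : ∀ (H : Graph n m) a v → excess H (δ a) v ≡ incidence H v a
  excess-δ H a v = trans (sum-cong-≗ (λ e → *-comm (incidence H v e) (δ a e))) (∑-δ a (incidence H v))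

  excess-sum : ∀ {k} (H : Graph n m) (F : Fin k → Fin m → ℚ) v →
               excess H (λ e → sum (λ j → F j e)) v ≡ sum (λ j → excess H (F j) v)
  excess-sum H F v = trans (sum-cong-≗ (λ e → *-distribˡ-sum (incidence H v e) (λ j → F j e)))
                           (∑-comm (λ e j → incidence H v e * F j e))

  excess-scale : ∀ (H : Graph n m) c p v → excess H (λ e → c * p e) v ≡ c * excess H p v
  excess-scale H c p v = trans (sum-cong-≗ (λ e → x∙yz≈y∙xz (incidence H v e) c (p e)))
                               (sym (*-distribˡ-sum c (λ e → incidence H v e * p e)))

  module _ {H : Graph n m} {e : Fin m} (c : DirCycleThrough H e) where
    open DirCycleThrough c

    cycleCount : Fin m → ℚ
    cycleCount e′ = sum (λ i → δ (es i) e′)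

    excess-cycleCount : ∀ v → excess H cycleCount v ≡ 0ℚ
    excess-cycleCount v = begin
      excess H cycleCount v
        ≡⟨ excess-sum H (λ i → δ (es i)) v ⟩
      sum (λ i → excess H (δ (es i)) v)
        ≡⟨ sum-cong-≗ (λ i → trans (excess-δ H (es i) v) (incidence≡δ-δ H v (es i))) ⟩
      sum (λ i → δ (head H (es i)) v - δ (tail H (es i)) v)
        ≡⟨ ∑-distrib-- (λ i → δ (head H (es i)) v) (λ i → δ (tail H (es i)) v) ⟩
      sum (λ i → δ (head H (es i)) v) - sum (λ i → δ (tail H (es i)) v)
        ≡⟨ cong (_- sum (λ i → δ (tail H (es i)) v))
             (sum-rotate (λ i → δ (head H (es i)) v) (λ i → δ (tail H (es i)) v)
               (λ i → cong (λ x → δ x v) (consec i)) (cong (λ x → δ x v) closes)) ⟩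
      sum (λ i → δ (tail H (es i)) v) - sum (λ i → δ (tail H (es i)) v)
        ≡⟨ +-inverseʳ (sum (λ i → δ (tail H (es i)) v)) ⟩
      0ℚ ∎
      where open ≡-Reasoning

    cycleCount-nonNeg : ∀ e′ → 0ℚ ≤ cycleCount e′
    cycleCount-nonNeg e′ = sum-nonNeg (λ i → 𝟙-nonNeg (does (es i ≟ e′)))

    1≤cycleCount : 1ℚ ≤ cycleCount e
    1≤cycleCount = subst (_≤ cycleCount e) (trans (cong (λ x → δ x e) starts) (δ-refl e))
      (term≤sum (λ i → 𝟙-nonNeg (does (es i ≟ e))) zero)

  totallyCyclic⇒openUnitCirculation : ∀ {H : Graph n m} → TotallyCyclic H →
    Σ (Fin m → ℚ) λ p → (∀ e → InOpenUnit (p e)) × (∀ v → excess H p v ≡ 0ℚ)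
  totallyCyclic⇒openUnitCirculation {H} tc =
    (λ e → ε * f e) , (λ e → scale (f e) (0<f e) (term≤sum f≥0 e)) , excess≡0
    where
    f : Fin m → ℚ
    f e = sum (λ e′ → cycleCount (tc e′) e)
    f≥0 : ∀ e → 0ℚ ≤ f e
    f≥0 e = sum-nonNeg (λ e′ → cycleCount-nonNeg (tc e′) e)
    0<f : ∀ e → 0ℚ < f e
    0<f e = <-≤-trans (positive⁻¹ 1ℚ)
      (≤-trans (1≤cycleCount (tc e)) (term≤sum (λ e′ → cycleCount-nonNeg (tc e′) e) e))
    ε : ℚ
    ε = proj₁ (scale-into-openUnit (sum f) (sum-nonNeg f≥0))
    scale : ∀ x → 0ℚ < x → x ≤ sum f → InOpenUnit (ε * x)
    scale = proj₂ (scale-into-openUnit (sum f) (sum-nonNeg f≥0))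
    excess≡0 : ∀ v → excess H (λ e → ε * f e) v ≡ 0ℚ
    excess≡0 v = begin
      excess H (λ e → ε * f e) v
        ≡⟨ excess-scale H ε f v ⟩
      ε * excess H f v
        ≡⟨ cong (ε *_) (excess-sum H (λ e′ → cycleCount (tc e′)) v) ⟩
      ε * sum (λ e′ → excess H (cycleCount (tc e′)) v)
        ≡⟨ cong (ε *_) (trans (sum-cong-≗ (λ e′ → excess-cycleCount (tc e′) v)) (sum-replicate-zero m)) ⟩
      ε * 0ℚ
        ≡⟨ *-zeroʳ ε ⟩
      0ℚ ∎
      where open ≡-Reasoning

  indeg outdeg : Graph n m → Fin n → ℕ
  indeg  H v = count (λ e → does (head H e ≟ v))
  outdeg H v = count (λ e → does (tail H e ≟ v))

  outdegs : Graph n m → Fin n → ℤ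
  outdegs H v = + outdeg H v

  excess-reorient : ∀ σ (G : Graph n m) y v →
    excess (reorient σ G) (reorientFlow σ y) v ≡ (ι (+ indeg (reorient σ G) v) - ι (+ outdeg G v)) - excess G y v
  excess-reorient σ G y v = begin
    sum (λ e → incidence σG v e * reorientFlow σ y e)
      ≡⟨ sum-cong-≗ per-edge ⟩
    sum (λ e → (δ (head σG e) v - δ (tail G e) v) - incidence G v e * y e)
      ≡⟨ ∑-distrib-- (λ e → δ (head σG e) v - δ (tail G e) v) (λ e → incidence G v e * y e) ⟩
    sum (λ e → δ (head σG e) v - δ (tail G e) v) - excess G y v
      ≡⟨ cong (_- excess G y v) (∑-distrib-- (λ e → δ (head σG e) v) (λ e → δ (tail G e) v)) ⟩
    (sum (λ e → δ (head σG e) v) - sum (λ e → δ (tail G e) v)) - excess G y v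
      ≡⟨ cong (λ s → s - excess G y v)
           (cong₂ _-_ (sum-𝟙≡count (λ e → does (head σG e ≟ v))) (sum-𝟙≡count (λ e → does (tail G e ≟ v)))) ⟩
    (ι (+ indeg σG v) - ι (+ outdeg G v)) - excess G y v ∎
    where
    open ≡-Reasoning
    σG : Graph n m
    σG = reorient σ G
    per-edge : ∀ e → incidence σG v e * reorientFlow σ y e ≡
                     (δ (head σG e) v - δ (tail G e) v) - incidence G v e * y e
    per-edge e rewrite incidence≡δ-δ σG v e | incidence≡δ-δ G v e with lookup σ e
    ... | true  = solve 3 (λ h t x → (t :- h) :* x := (t :- t) :- (h :- t) :* x) refl
                    (δ (head G e) v) (δ (tail G e) v) (y e)
      where open +-*-Solver
    ... | false = solve 3 (λ h t x → (h :- t) :* (con 1ℚ :- x) := (h :- t) :- (h :- t) :* x) refl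
                    (δ (head G e) v) (δ (tail G e) v) (y e)
      where open +-*-Solver

  openUnitCirculation⇒InB : ∀ (G : Graph n m) σ s → (∀ e → InOpenUnit (s e)) →
    (∀ v → excess (reorient σ G) s v ≡ 0ℚ) → InB G (shiftBy (ℤ.-_ ∘ outdegs G) (inDeg (reorient σ G)))
  openUnitCirculation⇒InB G σ s s∈ circ = y , (λ e → reorientFlow-openUnit σ {s} e (s∈ e)) , Ay≡b
    where
    σG : Graph n m
    σG = reorient σ G
    y : Fin m → ℚ
    y = reorientFlow σ s
    I-O-Ay≡0 : ∀ v → (ι (+ indeg σG v) - ι (+ outdeg G v)) - excess G y v ≡ 0ℚ
    I-O-Ay≡0 v = begin
      (ι (+ indeg σG v) - ι (+ outdeg G v)) - excess G y v ≡⟨ excess-reorient σ G y v ⟨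
      excess σG (reorientFlow σ y) v
        ≡⟨ sum-cong-≗ (λ e → cong (incidence σG v e *_) (reorientFlow-involutive σ s e)) ⟩
      excess σG s v                                        ≡⟨ circ v ⟩
      0ℚ                                                   ∎
      where open ≡-Reasoning
    Ay≡b : ∀ v → ∑ (λ e → incidence G v e * y e) ≡ ι (lookup (shiftBy (ℤ.-_ ∘ outdegs G) (inDeg σG)) v)
    Ay≡b v = begin
      ∑ (λ e → incidence G v e * y e)     ≡⟨ ∑≡sum (λ e → incidence G v e * y e) ⟩
      excess G y v                        ≡⟨ x∙y⁻¹≈ε⇒x≈y _ (excess G y v) (I-O-Ay≡0 v) ⟨
      ι (+ indeg σG v) - ι (+ outdeg G v) ≡⟨ ι-homo-- (+ indeg σG v) (+ outdeg G v) ⟨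
      ι (+ indeg σG v ℤ.- + outdeg G v)
        ≡⟨ cong ι (trans (lookup∘tabulate _ v) (cong (ℤ._- + outdeg G v) (lookup∘tabulate _ v))) ⟨
      ι (lookup (shiftBy (ℤ.-_ ∘ outdegs G) (inDeg σG)) v) ∎
      where open ≡-Reasoning

  totallyCyclicReorientation⇒InB : ∀ (G : Graph n m) σ → TotallyCyclicReorientation G σ →
    InB G (shiftBy (ℤ.-_ ∘ outdegs G) (inDeg (reorient σ G)))
  totallyCyclicReorientation⇒InB G σ tc =
    let s , s∈ , circ = totallyCyclic⇒openUnitCirculation tc in openUnitCirculation⇒InB G σ s s∈ circ

-- Simple walks and ancestor sets

module _ {n m : ℕ} (H : Graph n m) where

  Walk : Fin n → List (Fin m) → Fin n → Set
  Walk u []       t = u ≡ t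
  Walk u (e ∷ es) t = (tail H e ≡ u) × Walk (head H e) es t

  verts : Fin n → List (Fin m) → List (Fin n)
  verts u es = u ∷ List.map (head H) es

  end∈verts : ∀ {u es t} → Walk u es t → t ∈ verts u es
  end∈verts {es = []}     u≡t       = here (sym u≡t)
  end∈verts {es = e ∷ es} (_ , wk) = there (end∈verts wk)

  tail∈verts : ∀ {u es t} → Walk u es t → ∀ i → tail H (List.lookup es i) ∈ verts u es
  tail∈verts {es = e ∷ es} (te≡u , wk) zero    = here te≡u
  tail∈verts {es = e ∷ es} (te≡u , wk) (suc i) = there (tail∈verts wk i)

  tail≢end : ∀ {u es t} → Walk u es t → Unique (verts u es) → ∀ i → tail H (List.lookup es i) ≢ t
  tail≢end {es = e ∷ es} (te≡u , wk) (u∉ ∷ _) zero    te≡t = All.lookup u∉ (end∈verts wk) (trans (sym te≡u) te≡t)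
  tail≢end {es = e ∷ es} (te≡u , wk) (_ ∷ !)  (suc i)      = tail≢end wk ! i

  tails-injective : ∀ {u es t} → Walk u es t → Unique (verts u es) →
                    ∀ i j → tail H (List.lookup es i) ≡ tail H (List.lookup es j) → i ≡ j
  tails-injective {es = e ∷ es} wk          !         zero    zero    _  = refl
  tails-injective {es = e ∷ es} (te≡u , wk) (u∉ ∷ _) zero    (suc j) eq =
    ⊥-elim (All.lookup u∉ (tail∈verts wk j) (trans (sym te≡u) eq))
  tails-injective {es = e ∷ es} (te≡u , wk) (u∉ ∷ _) (suc i) zero    eq =
    ⊥-elim (All.lookup u∉ (tail∈verts wk i) (trans (sym te≡u) (sym eq)))
  tails-injective {es = e ∷ es} (_ , wk)    (_ ∷ !)  (suc i) (suc j) eq = cong suc (tails-injective wk ! i j eq)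

  closeCycle : ∀ e es → Walk (head H e) es (tail H e) → Unique (verts (head H e) es) → DirCycleThrough H e
  closeCycle e es wk ! = record
    { len      = List.length es
    ; es       = List.lookup (e ∷ es)
    ; starts   = refl
    ; consec   = consec es wk
    ; closes   = closes es wk
    ; distinct = distinct
    }
    where
    consec : ∀ {f} es → Walk (head H f) es (tail H e) → ∀ (i : Fin (List.length es)) →
             head H (List.lookup (f ∷ es) (inject₁ i)) ≡ tail H (List.lookup (f ∷ es) (suc i))
    consec (f ∷ es) (tf≡ , wk) zero    = sym tf≡
    consec (f ∷ es) (_ , wk)   (suc i) = consec es wk i
    closes : ∀ {f} es → Walk (head H f) es (tail H e) →
             head H (List.lookup (f ∷ es) (fromℕ (List.length es))) ≡ tail H e
    closes []       hf≡te     = hf≡te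
    closes (f ∷ es) (_ , wk) = closes es wk
    distinct : ∀ i j → tail H (List.lookup (e ∷ es) i) ≡ tail H (List.lookup (e ∷ es) j) → i ≡ j
    distinct zero    zero    _  = refl
    distinct zero    (suc j) eq = ⊥-elim (tail≢end wk ! j (sym eq))
    distinct (suc i) zero    eq = ⊥-elim (tail≢end wk ! i eq)
    distinct (suc i) (suc j) eq = cong suc (tails-injective wk ! i j eq)

  PredecessorClosed : (Fin n → Bool) → Set
  PredecessorClosed R = ∀ e → R (head H e) ≡ true → R (tail H e) ≡ true

  record Ancestors (t : Fin n) : Set where
    field
      R        : Fin n → Bool
      R-target : R t ≡ true
      R-closed : PredecessorClosed R
      walkTo   : ∀ u → R u ≡ true → Σ (List (Fin m)) λ es → Walk u es t × Unique (verts u es)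

  module _ (t : Fin n) where

    WalksWithin : (Fin n → Bool) → Set
    WalksWithin R = ∀ u → R u ≡ true →
      Σ (List (Fin m)) λ es → Walk u es t × Unique (verts u es) × All (λ x → R x ≡ true) (verts u es)

    -- The new vertex lies outside R and the walk from head e inside R, so prepending e keeps it simple.
    walksWithin-insert : ∀ R e → R (head H e) ≡ true → R (tail H e) ≡ false →
                         WalksWithin R → WalksWithin (insert R (tail H e))
    walksWithin-insert R e Rh Rt walks u R′u with R u in Ru
    ... | true with walks u Ru
    ...   | es , wk , ! , within = es , wk , ! , All.map (insert-⊇ R (tail H e)) within
    walksWithin-insert R e Rh Rt walks u R′u | false with u ≟ tail H e
    ... | yes refl with walks (head H e) Rh
    ...   | es , wk , ! , within =
      e ∷ es , (refl , wk) , All.map te≢ within ∷ ! , insert-new R (tail H e) ∷ All.map (insert-⊇ R (tail H e)) within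
      where
      te≢ : ∀ {x} → R x ≡ true → tail H e ≢ x
      te≢ Rx refl with () ← trans (sym Rx) Rt
    walksWithin-insert R e Rh Rt walks u () | false | no _

    ancestorsFrom : ∀ k R → R t ≡ true → WalksWithin R → n ℕ.≤ k ℕ.+ count R → Ancestors t
    ancestorsFrom k R Rt walks bound
      with any? (λ e → (R (head H e) Bool.≟ true) ×-dec (R (tail H e) Bool.≟ false))
    ... | no no-entering-edge = record { R = R ; R-target = Rt ; R-closed = closed ; walkTo = walkTo }
      where
      closed : PredecessorClosed R
      closed e Rh with R (tail H e) in Rte
      ... | true  = refl
      ... | false = ⊥-elim (no-entering-edge (e , Rh , Rte))
      walkTo : ∀ u → R u ≡ true → Σ (List (Fin m)) λ es → Walk u es t × Unique (verts u es)
      walkTo u Ru = let es , wk , ! , _ = walks u Ru in es , wk , !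
    ... | yes (e , Rh , Rte) with k
    ...   | zero  = ⊥-elim (ℕ.<⇒≱ (count<size R (tail H e) Rte) bound)
    ...   | suc k = ancestorsFrom k (insert R (tail H e)) (insert-⊇ R (tail H e) Rt)
                      (walksWithin-insert R e Rh Rte walks)
                      (subst (λ c → n ℕ.≤ k ℕ.+ c) (sym (count-insert R (tail H e) Rte))
                        (subst (n ℕ.≤_) (sym (ℕ.+-suc k (count R))) bound))

  ancestors : ∀ t → Ancestors t
  ancestors t = ancestorsFrom t n (λ x → does (x ≟ t)) (dec-true (t ≟ t) refl) walks (ℕ.m≤m+n n _)
    where
    walks : WalksWithin t (λ x → does (x ≟ t))
    walks u Ru with u ≟ t
    ... | yes refl = [] , refl , [] ∷ [] , dec-true (u ≟ u) refl ∷ []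
    walks u () | no _

-- Net flow into a set of vertices

module _ {n m : ℕ} (H : Graph n m) (p : Fin m → ℚ) (p>0 : ∀ e → 0ℚ < p e) where

  excessWithin : (Fin n → Bool) → ℚ
  excessWithin R = sum (λ v → 𝟙 (R v) * excess H p v)

  private
    flowAcross : (Fin n → Bool) → Fin m → ℚ
    flowAcross R e = p e * (𝟙 (R (head H e)) - 𝟙 (R (tail H e)))

    p*[0-1]<0 : ∀ e → p e * (0ℚ - 1ℚ) < 0ℚ
    p*[0-1]<0 e = subst (_< 0ℚ) (sym (x*[0-1]≡-x (p e))) (neg-antimono-< (p>0 e))
      where
      open +-*-Solver
      x*[0-1]≡-x : ∀ x → x * (0ℚ - 1ℚ) ≡ - x
      x*[0-1]≡-x = solve 1 (λ x → x :* (con 0ℚ :- con 1ℚ) := :- x) refl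

    flowAcross-leaving : ∀ R e → R (head H e) ≡ false → R (tail H e) ≡ true → flowAcross R e < 0ℚ
    flowAcross-leaving R e Rh Rt rewrite Rh | Rt = p*[0-1]<0 e

    flowAcross≤0 : ∀ R → PredecessorClosed H R → ∀ e → flowAcross R e ≤ 0ℚ
    flowAcross≤0 R closed e with R (head H e) in Rh | R (tail H e) in Rt
    ... | true  | true  = ≤-reflexive (*-zeroʳ (p e))
    ... | false | false = ≤-reflexive (*-zeroʳ (p e))
    ... | false | true  = <⇒≤ (p*[0-1]<0 e)
    ... | true  | false with () ← trans (sym (closed e Rh)) Rt

  excessWithin≡flowAcross : ∀ R → excessWithin R ≡ sum (flowAcross R)
  excessWithin≡flowAcross R = ∑-weighted-excess H (λ v → 𝟙 (R v)) p

  excessWithin≤0 : ∀ R → PredecessorClosed H R → excessWithin R ≤ 0ℚ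
  excessWithin≤0 R closed = subst (_≤ 0ℚ) (sym (excessWithin≡flowAcross R)) (sum-nonPos (flowAcross≤0 R closed))

  excessWithin<0 : ∀ R → PredecessorClosed H R → ∀ e → R (head H e) ≡ false → R (tail H e) ≡ true →
                   excessWithin R < 0ℚ
  excessWithin<0 R closed e Rh Rt = subst (_< 0ℚ) (sym (excessWithin≡flowAcross R))
    (≤-<-trans (sum≤term (flowAcross≤0 R closed) e) (flowAcross-leaving R e Rh Rt))

  excessWithin-circulation : (∀ v → excess H p v ≡ 0ℚ) → ∀ R → excessWithin R ≡ 0ℚ
  excessWithin-circulation circ R =
    trans (sum-cong-≗ (λ v → trans (cong (𝟙 (R v) *_) (circ v)) (*-zeroʳ (𝟙 (R v))))) (sum-replicate-zero n)

  positiveCirculation⇒totallyCyclic : (∀ v → excess H p v ≡ 0ℚ) → TotallyCyclic H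
  positiveCirculation⇒totallyCyclic circ e with ancestors H (tail H e)
  ... | record { R = R ; R-target = Rt ; R-closed = closed ; walkTo = walkTo } with R (head H e) in Rh
  ...   | true  = let es , wk , ! = walkTo (head H e) Rh in closeCycle H e es wk !
  ...   | false = ⊥-elim (<-irrefl (excessWithin-circulation circ R) (excessWithin<0 R closed e Rh Rt))

-- Reversing a walk

module _ {n m : ℕ} {H H′ : Graph n m} (x : Fin n)
         (agree : ∀ e → tail H e ≢ x → (head H′ e ≡ head H e) × (tail H′ e ≡ tail H e)) where

  walk-transport : ∀ {u es t} → All (_≢ x) (verts H u es) → Walk H u es t →
                   Walk H′ u es t × (verts H′ u es ≡ verts H u es)
  walk-transport {es = []}     _               u≡t         = u≡t , refl
  walk-transport {u} {e ∷ es} (u≢x ∷ avoids) (te≡u , wk) with agree e (λ te≡x → u≢x (trans (sym te≡u) te≡x))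
  ... | h′≡h , t′≡t with walk-transport avoids wk
  ...   | wk′ , verts≡ =
    (trans t′≡t te≡u , subst (λ h → Walk H′ h es _) (sym h′≡h) wk′) ,
    cong (u ∷_) (trans (cong (λ h → h ∷ List.map (head H′) es) h′≡h) verts≡)

module _ {n m : ℕ} (G : Graph n m) where

  flipAt : Subset m → Fin m → Subset m
  flipAt σ e = updateAt σ e not

  head-flipAt : ∀ σ e → head (reorient (flipAt σ e) G) e ≡ tail (reorient σ G) e
  head-flipAt σ e rewrite lookup∘updateAt e {not} σ with lookup σ e
  ... | true  = refl
  ... | false = refl

  reorient-flipAt-other : ∀ σ e i → i ≢ e →
    (head (reorient (flipAt σ e) G) i ≡ head (reorient σ G) i) ×
    (tail (reorient (flipAt σ e) G) i ≡ tail (reorient σ G) i)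
  reorient-flipAt-other σ e i i≢e rewrite lookup∘updateAt′ i e {not} i≢e σ = refl , refl

  indeg-flipAt : ∀ σ e x →
    indeg (reorient (flipAt σ e) G) x ℕ.+ bit (does (head (reorient σ G) e ≟ x)) ≡
    indeg (reorient σ G) x ℕ.+ bit (does (tail (reorient σ G) e ≟ x))
  indeg-flipAt σ e x = trans
    (count-update (λ i → does (head (reorient σ G) i ≟ x)) (λ i → does (head (reorient (flipAt σ e) G) i ≟ x)) e
      (λ i i≢e → cong (λ h → does (h ≟ x)) (proj₁ (reorient-flipAt-other σ e i i≢e))))
    (cong (λ h → indeg (reorient σ G) x ℕ.+ bit (does (h ≟ x))) (head-flipAt σ e))

  -- Simplicity keeps the tails of the later edges away from u = tail e, so reversing e leaves them intact.
  flipWalk : ∀ σ {u es t} → Walk (reorient σ G) u es t → Unique (verts (reorient σ G) u es) →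
             Σ (Subset m) λ σ′ → ∀ x → indeg (reorient σ′ G) x ℕ.+ bit (does (t ≟ x)) ≡
                                       indeg (reorient σ G) x ℕ.+ bit (does (u ≟ x))
  flipWalk σ {es = []} refl _ = σ , λ _ → refl
  flipWalk σ {u} {e ∷ es} {t} (te≡u , wk) (u∉ ∷ !)
    with walk-transport u (λ i ti≢u → reorient-flipAt-other σ e i (λ i≡e → ti≢u (trans (cong _ i≡e) te≡u)))
           (All.map (λ u≢v v≡u → u≢v (sym v≡u)) u∉) wk
  ... | wk′ , verts≡ with flipWalk (flipAt σ e) wk′ (subst Unique (sym verts≡) !)
  ...   | σ′ , indeg≡ = σ′ , λ x → begin
    indeg (reorient σ′ G) x ℕ.+ bit (does (t ≟ x))
      ≡⟨ indeg≡ x ⟩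
    indeg (reorient (flipAt σ e) G) x ℕ.+ bit (does (head (reorient σ G) e ≟ x))
      ≡⟨ indeg-flipAt σ e x ⟩
    indeg (reorient σ G) x ℕ.+ bit (does (tail (reorient σ G) e ≟ x))
      ≡⟨ cong (λ v → indeg (reorient σ G) x ℕ.+ bit (does (v ≟ x))) te≡u ⟩
    indeg (reorient σ G) x ℕ.+ bit (does (u ≟ x)) ∎
    where open ≡-Reasoning

-- Balancing the defect

module ℕΣ = MonoidSum ℕ.+-0-monoid

δℤ : ∀ {k} → Fin k → Fin k → ℤ
δℤ a x = + bit (does (a ≟ x))

ℕΣ-mono-≤ : ∀ {k} {f g : Fin k → ℕ} → (∀ i → f i ℕ.≤ g i) → ℕΣ.sum f ℕ.≤ ℕΣ.sum g
ℕΣ-mono-≤ {zero}  f≤g = ℕ.z≤n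
ℕΣ-mono-≤ {suc k} f≤g = ℕ.+-mono-≤ (f≤g zero) (ℕΣ-mono-≤ (λ i → f≤g (suc i)))

ℕΣ-mono-< : ∀ {k} {f g : Fin k → ℕ} → (∀ i → f i ℕ.≤ g i) → ∀ a → f a ℕ.< g a → ℕΣ.sum f ℕ.< ℕΣ.sum g
ℕΣ-mono-< {suc k} f≤g zero    fa<ga = ℕ.+-mono-<-≤ fa<ga (ℕΣ-mono-≤ (λ i → f≤g (suc i)))
ℕΣ-mono-< {suc k} f≤g (suc a) fa<ga = ℕ.+-mono-≤-< (f≤g zero) (ℕΣ-mono-< (λ i → f≤g (suc i)) a fa<ga)

∣i+1∣<∣i∣ : ∀ i → i ℤ.< + 0 → ℤ.∣ i ℤ.+ + 1 ∣ ℕ.< ℤ.∣ i ∣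
∣i+1∣<∣i∣ ℤ.-[1+ zero  ] _ = ℕ.≤-refl
∣i+1∣<∣i∣ ℤ.-[1+ suc k ] _ = ℕ.≤-refl
∣i+1∣<∣i∣ (+ k) (ℤ.+<+ ())

∣i-1∣<∣i∣ : ∀ i → + 0 ℤ.< i → ℤ.∣ i ℤ.- + 1 ∣ ℕ.< ℤ.∣ i ∣
∣i-1∣<∣i∣ (+ suc k) _ = ℕ.≤-refl
∣i-1∣<∣i∣ (+ zero) (ℤ.+<+ ())

ℕΣ∣∣-decreases : ∀ {k} (D D′ : Fin k → ℤ) {u t} → D u ℤ.< + 0 → + 0 ℤ.< D t →
                 (∀ x → D′ x ≡ D x ℤ.+ (δℤ u x ℤ.- δℤ t x)) →
                 ℕΣ.sum (λ x → ℤ.∣ D′ x ∣) ℕ.< ℕΣ.sum (λ x → ℤ.∣ D x ∣)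
ℕΣ∣∣-decreases D D′ {u} {t} Du<0 0<Dt D′≡ =
  ℕΣ-mono-< ∣D′∣≤∣D∣ u (subst (λ d → ℤ.∣ d ∣ ℕ.< ℤ.∣ D u ∣) (sym (D′≡ u)) ∣D′u∣<∣Du∣)
  where
  u≢t : u ≢ t
  u≢t refl = ℤ.<-asym Du<0 0<Dt
  ∣D′∣≤∣D∣ : ∀ x → ℤ.∣ D′ x ∣ ℕ.≤ ℤ.∣ D x ∣
  ∣D′∣≤∣D∣ x rewrite D′≡ x with u ≟ x | t ≟ x
  ... | yes refl | yes refl = ⊥-elim (u≢t refl)
  ... | yes refl | no _     = ℕ.<⇒≤ (∣i+1∣<∣i∣ (D x) Du<0)
  ... | no _     | yes refl = ℕ.<⇒≤ (∣i-1∣<∣i∣ (D x) 0<Dt)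
  ... | no _     | no _     = ℕ.≤-reflexive (cong ℤ.∣_∣ (ℤ.+-identityʳ (D x)))
  ∣D′u∣<∣Du∣ : ℤ.∣ D u ℤ.+ (δℤ u u ℤ.- δℤ t u) ∣ ℕ.< ℤ.∣ D u ∣
  ∣D′u∣<∣Du∣ rewrite dec-true (u ≟ u) refl | dec-false (t ≟ u) (u≢t ∘ sym) = ∣i+1∣<∣i∣ (D u) Du<0

zeroSum⇒positive : ∀ {k} (D : Fin k → ℤ) → sum (λ v → ι (D v)) ≡ 0ℚ → ∀ u → D u ≢ + 0 → ∃ λ t → + 0 ℤ.< D t
zeroSum⇒positive D ∑D≡0 u Du≢0 with any? (λ t → + 0 ℤ.<? D t)
... | yes found = found
... | no  ¬positive = ⊥-elim (<-irrefl ∑D≡0 (≤-<-trans (sum≤term ιD≤0 u) (ι-mono-< Du<0)))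
  where
  D≤0 : ∀ v → D v ℤ.≤ + 0
  D≤0 v = ℤ.≮⇒≥ (λ 0<Dv → ¬positive (v , 0<Dv))
  ιD≤0 : ∀ v → ι (D v) ≤ 0ℚ
  ιD≤0 v = ι-mono-≤ (D≤0 v)
  Du<0 : D u ℤ.< + 0
  Du<0 = ℤ.≤∧≢⇒< (D≤0 u) Du≢0

negativeWithin : ∀ {k} (D : Fin k → ℤ) (R : Fin k → Bool) → sum (λ v → 𝟙 (R v) * ι (D v)) ≤ 0ℚ →
                 ∀ t → R t ≡ true → + 0 ℤ.< D t → ∃ λ v → R v ≡ true × D v ℤ.< + 0
negativeWithin D R ∑≤0 t Rt 0<Dt with any? (λ v → (R v Bool.≟ true) ×-dec (D v ℤ.<? + 0))
... | yes found = found
... | no  ¬negative = ⊥-elim (<-irrefl refl (<-≤-trans 0<∑ ∑≤0))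
  where
  terms≥0 : ∀ v → 0ℚ ≤ 𝟙 (R v) * ι (D v)
  terms≥0 v with R v in Rv
  ... | true  = subst (0ℚ ≤_) (sym (*-identityˡ (ι (D v)))) (ι-mono-≤ (ℤ.≮⇒≥ (λ Dv<0 → ¬negative (v , Rv , Dv<0))))
  ... | false = ≤-reflexive (sym (*-zeroˡ (ι (D v))))
  0<∑ : 0ℚ < sum (λ v → 𝟙 (R v) * ι (D v))
  0<∑ = <-≤-trans (subst (0ℚ <_) (sym (trans (cong (λ b → 𝟙 b * ι (D t)) Rt) (*-identityˡ (ι (D t)))))
                    (ι-mono-< 0<Dt))
                  (term≤sum terms≥0 t)

module _ {n m : ℕ} (G : Graph n m) (b : Vec ℤ n) (y : Fin m → ℚ) (y∈ : ∀ e → InOpenUnit (y e))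
         (excess-y : ∀ v → excess G y v ≡ ι (lookup b v)) where

  private
    flow : Subset m → Fin m → ℚ
    flow σ = reorientFlow σ y

    flow>0 : ∀ σ e → 0ℚ < flow σ e
    flow>0 σ e = proj₁ (reorientFlow-openUnit σ {y} e (y∈ e))

  defect : Subset m → Fin n → ℤ
  defect σ v = (+ indeg (reorient σ G) v ℤ.- + outdeg G v) ℤ.- lookup b v

  excess-defect : ∀ σ v → excess (reorient σ G) (flow σ) v ≡ ι (defect σ v)
  excess-defect σ v = begin
    excess (reorient σ G) (flow σ) v
      ≡⟨ excess-reorient σ G y v ⟩
    (ι (+ indeg (reorient σ G) v) - ι (+ outdeg G v)) - excess G y v
      ≡⟨ cong₂ _-_ (sym (ι-homo-- (+ indeg (reorient σ G) v) (+ outdeg G v))) (excess-y v) ⟩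
    ι (+ indeg (reorient σ G) v ℤ.- + outdeg G v) - ι (lookup b v)
      ≡⟨ ι-homo-- (+ indeg (reorient σ G) v ℤ.- + outdeg G v) (lookup b v) ⟨
    ι (defect σ v) ∎
    where open ≡-Reasoning

  defect-flipWalk : ∀ σ σ′ u t →
    (∀ x → indeg (reorient σ′ G) x ℕ.+ bit (does (t ≟ x)) ≡ indeg (reorient σ G) x ℕ.+ bit (does (u ≟ x))) →
    ∀ x → defect σ′ x ≡ defect σ x ℤ.+ (δℤ u x ℤ.- δℤ t x)
  defect-flipWalk σ σ′ u t indeg≡ x = begin
    (I′ ℤ.- O) ℤ.- β                           ≡⟨ add-and-subtract I′ (δℤ t x) O β ⟩
    ((I′ ℤ.+ δℤ t x ℤ.- O) ℤ.- β) ℤ.- δℤ t x   ≡⟨ cong (λ s → ((s ℤ.- O) ℤ.- β) ℤ.- δℤ t x) (cong +_ (indeg≡ x)) ⟩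
    ((I ℤ.+ δℤ u x ℤ.- O) ℤ.- β) ℤ.- δℤ t x    ≡⟨ regroup I (δℤ u x) O β (δℤ t x) ⟩
    ((I ℤ.- O) ℤ.- β) ℤ.+ (δℤ u x ℤ.- δℤ t x)  ∎
    where
    open ≡-Reasoning
    I′ I O β : ℤ
    I′ = + indeg (reorient σ′ G) x
    I  = + indeg (reorient σ G) x
    O  = + outdeg G x
    β  = lookup b x
    add-and-subtract : ∀ i a o β → (i ℤ.- o) ℤ.- β ≡ ((i ℤ.+ a ℤ.- o) ℤ.- β) ℤ.- a
    add-and-subtract = ℤ-Ring.solve-∀
    regroup : ∀ i c o β a → ((i ℤ.+ c ℤ.- o) ℤ.- β) ℤ.- a ≡ ((i ℤ.- o) ℤ.- β) ℤ.+ (c ℤ.- a)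
    regroup = ℤ-Ring.solve-∀

  balanced⇒indeg : ∀ σ v → defect σ v ≡ + 0 → + indeg (reorient σ G) v ≡ lookup b v ℤ.+ + outdeg G v
  balanced⇒indeg σ v D≡0 = begin
    I                                 ≡⟨ split I O β ⟩
    ((I ℤ.- O) ℤ.- β) ℤ.+ (β ℤ.+ O)   ≡⟨ cong (ℤ._+ (β ℤ.+ O)) D≡0 ⟩
    + 0 ℤ.+ (β ℤ.+ O)                 ≡⟨ ℤ.+-identityˡ (β ℤ.+ O) ⟩
    β ℤ.+ O                           ∎
    where
    open ≡-Reasoning
    I O β : ℤ
    I = + indeg (reorient σ G) v
    O = + outdeg G v
    β = lookup b v
    split : ∀ i o β → i ≡ ((i ℤ.- o) ℤ.- β) ℤ.+ (β ℤ.+ o)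
    split = ℤ-Ring.solve-∀

  Φ : Subset m → ℕ
  Φ σ = ℕΣ.sum (λ v → ℤ.∣ defect σ v ∣)

  sum-defect≡0 : ∀ σ → sum (λ v → ι (defect σ v)) ≡ 0ℚ
  sum-defect≡0 σ = trans (sum-cong-≗ (λ v → sym (excess-defect σ v))) (sum-excess≡0 (reorient σ G) (flow σ))

  defectWithin≤0 : ∀ σ R → PredecessorClosed (reorient σ G) R → sum (λ v → 𝟙 (R v) * ι (defect σ v)) ≤ 0ℚ
  defectWithin≤0 σ R closed = subst (_≤ 0ℚ) (sum-cong-≗ (λ v → cong (𝟙 (R v) *_) (excess-defect σ v)))
    (excessWithin≤0 (reorient σ G) (flow σ) (flow>0 σ) R closed)

  improve : ∀ σ u → defect σ u ≢ + 0 → Σ (Subset m) λ σ′ → Φ σ′ ℕ.< Φ σ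
  improve σ u Du≢0 =
    let t , 0<Dt     = zeroSum⇒positive (defect σ) (sum-defect≡0 σ) u Du≢0
        open Ancestors (ancestors (reorient σ G) t)
        v , Rv , Dv<0 = negativeWithin (defect σ) R (defectWithin≤0 σ R R-closed) t R-target 0<Dt
        es , wk , !   = walkTo v Rv
        σ′ , indeg≡   = flipWalk G σ wk !
    in σ′ , ℕΣ∣∣-decreases (defect σ) (defect σ′) Dv<0 0<Dt (defect-flipWalk σ σ′ v t indeg≡)

  balance : ∀ σ → Acc ℕ._<_ (Φ σ) → Σ (Subset m) λ σ′ → ∀ v → defect σ′ v ≡ + 0
  balance σ (acc smaller) = decide (all? (λ v → defect σ v ℤ.≟ + 0))
    where
    decide : Dec (∀ v → defect σ v ≡ + 0) → Σ (Subset m) λ σ′ → ∀ v → defect σ′ v ≡ + 0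
    decide (yes balanced)   = σ , balanced
    decide (no  unbalanced) =
      let u , Du≢0    = ¬∀⟶∃¬ n _ (λ v → defect σ v ℤ.≟ + 0) unbalanced
          σ′ , Φσ′<Φσ = improve σ u Du≢0
      in balance σ′ (smaller Φσ′<Φσ)

  balancedReorientation :
    Σ (Subset m) λ σ → TotallyCyclicReorientation G σ × (inDeg (reorient σ G) ≡ shiftBy (outdegs G) b)
  balancedReorientation =
    let σ , balanced = balance (tabulate (λ _ → false)) (ℕ.<-wellFounded _)
    in σ , positiveCirculation⇒totallyCyclic (reorient σ G) (flow σ) (flow>0 σ)
             (λ v → trans (excess-defect σ v) (cong ι (balanced v)))
         , tabulate-cong (λ v → balanced⇒indeg σ v (balanced v))

module _ {n m : ℕ} (G : Graph n m) where

  InB⇒inDegSeqOfTCR : ∀ {b} → InB G b → InDegSeqOfTCR G (shiftBy (outdegs G) b)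
  InB⇒inDegSeqOfTCR {b} (y , y∈ , Ay≡b) =
    balancedReorientation G b y y∈ (λ v → trans (sym (∑≡sum (λ e → incidence G v e * y e))) (Ay≡b v))

  inDegSeqOfTCR⇒InB : ∀ {b′} → InDegSeqOfTCR G b′ → InB G (shiftBy (ℤ.-_ ∘ outdegs G) b′)
  inDegSeqOfTCR⇒InB (σ , tc , refl) = totallyCyclicReorientation⇒InB G σ tc

theorem2p8 : ∀ {n m} (G : Graph n m) → Bijection (BSetoid G) (TCRInDegSetoid G)
theorem2p8 G = Inverse⇒Bijection record
  { to        = λ (b , b∈B) → shiftBy (outdegs G) b , InB⇒inDegSeqOfTCR G {b} b∈B
  ; from      = λ (b′ , b′∈I) → shiftBy (ℤ.-_ ∘ outdegs G) b′ , inDegSeqOfTCR⇒InB G {b′} b′∈I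
  ; to-cong   = cong (shiftBy (outdegs G))
  ; from-cong = cong (shiftBy (ℤ.-_ ∘ outdegs G))
  ; inverse   = (λ {x} eq → trans (cong (shiftBy (outdegs G)) eq)
                                  (shiftBy-cancel _ _ (ℤ.+-inverseˡ ∘ outdegs G) (proj₁ x)))
              , (λ {x} eq → trans (cong (shiftBy (ℤ.-_ ∘ outdegs G)) eq)
                                  (shiftBy-cancel _ _ (ℤ.+-inverseʳ ∘ outdegs G) (proj₁ x)))
  }
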